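{- Let $\sim$ be a $\gamma$-congruence on a GPEA $P$ which satisfies conditions (C4) and (C5$'$). Let $\sim^*$ be the extension of $\sim$ in the $\gamma$-unitization $U$ of $P$. Define $\widetilde{\gamma}:P/{\sim}\to P/{\sim}$ by $\widetilde{\gamma}[a]=[\gamma a]$. Then $\widetilde{\gamma}$ is a unitizing automorphism in $P/{\sim}$, and $U/{\sim^*}$ is the $\widetilde{\gamma}$-unitization of $P/{\sim}$. In particular, if $I$ is a normal Riesz $\gamma$-ideal on $P$ such that $\sim_I$ satisfies (GCR), then the $\widetilde{\gamma}$-unitization of $P/I$ is $U/I$.
   Context: $P$ is a GPEA (partial $\oplus$, constant $0$; partial associativity; conjugation; two-sided cancellation; neutral $0$; positivity), ordered by $a\le b$ iff $a\oplus c=b$ for some $c$; for $a\le b$, $a/b$ is the unique $c$ with $a\oplus c=b$ and $b\backslash a$ the unique $d$ with $d\oplus a=b$. $\gamma$ is a unitizing GPEA-automorphism ($\gamma a\oplus b$ defined iff $b\oplus a$ defined). The $\gamma$-unitization $U=P\cup P^\eta$ ($\eta$ a bijection onto a disjoint set, $1:=\eta0$): sums in $P$ as in $P$; $a+\eta b$ defined iff $a\le b$, equal to $\eta(b\backslash a)$; $\eta a+b$ defined iff $\gamma b\le a$, equal to $\eta(\gamma b/a)$; no sums within $P^\eta$; $U$ is a pseudo effect algebra with $\eta a=a^\sim$, $\gamma a=a^{ -- }$. A congruence: equivalence relation with (C2) $a\oplus b$, $a_1\oplus b_1$ exist, $a\sim a_1$, $b\sim b_1\Rightarrow a\oplus b\sim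 a_1\oplus b_1$, and (C3) if $a\oplus b$ exists, for any $a_1\sim a$ some $b_1\sim b$ has $a_1\oplus b_1$ existing and for any $b_2\sim b$ some $a_2\sim a$ has $a_2\oplus b_2$ existing. (C4): $a\sim b$ and ($a\oplus a_1\sim b\oplus b_1$ or $a_1\oplus a\sim b_1\oplus b$) imply $a_1\sim b_1$. (C5$'$): $a\sim b\oplus c$ implies $a=a_1\oplus a_2$ with $a_1\sim b$, $a_2\sim c$. $\gamma$-congruence: $a\sim b\Leftrightarrow\gamma a\sim\gamma b$. $\sim^*$: $a\sim^*b$ iff $a\sim b$, $\eta a\sim^*\eta b$ iff $a\sim b$, elements of $P$ and $P^\eta$ never related. On the quotient, $[a]\oplus[b]$ exists iff $a_1\oplus b_1$ exists for some $a_1\sim a$, $b_1\sim b$, and then equals $[a_1\oplus b_1]$. Ideal, normal, $\gamma$-ideal, Riesz ideal as usual: ideal = nonempty down-set closed under existing sums; normal: $a\oplus c=c\oplus b\Rightarrow(a\in I\Leftrightarrow b\in I)$; $\gamma$-ideal: $a\in I\Leftrightarrow\gamma a\in I$; Riesz: (R1) $i\in I$, $i\le a\oplus b\Rightarrow i\le j\oplus k$, $j,k\in I$, $j\le a$, $k\le b$; (R2) $i\in I$, $i\le a$: if $(a\backslash i)\oplus b$ exists then some $j\in I$, $j\le b$, has $a\oplus(j/b)$ existing, and if $b\oplus(i/a)$ exists then some $k\in I$, $k\le b$, has $(b\backslash k)\oplus a$ existing. $a\sim_I b$ iff $a\backslash i=b\backslash j$ for some $i,j\in I$, $i\le a$,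 $j\le b$; $P/I$ and $U/I$ denote the quotients by $\sim_I$ and its extension $\sim_I^*$. (GCR): $a\sim_I b$ implies $i\oplus a=j\oplus b$ for some $i,j\in I$. -}

module Defs where

open import Level using (0ℓ)
open import Data.Product using (Σ; ∃; ∃-syntax; _×_; _,_)
open import Data.Sum using (_⊎_; inj₁; inj₂)
open import Data.Empty using (⊥)
open import Relation.Binary.Core using (Rel)
open import Relation.Binary.Structures using (IsEquivalence)
open import Function.Bundles using (_⇔_)

-- A partial binary operation ⊕ on A, encoded as a ternary relation:
-- S a b c  means  "a ⊕ b is defined and a ⊕ b = c".
SumRel : Set → Set₁
SumRel A = A → A → A → Set

-- GPEA over a carrier with an equality _≈_ (for P itself we use _≡_;
-- for quotients P/~ we use the carrier P with _≈_ := ~, the setoid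
-- encoding of a quotient).
record IsGPEA (A : Set) (_≈_ : Rel A 0ℓ) (S : SumRel A) (𝟘 : A) : Set where
  field
    isEquivalence : IsEquivalence _≈_
    S-resp   : ∀ {a a' b b' c c'} → a ≈ a' → b ≈ b' → c ≈ c' → S a b c → S a' b' c'
    S-func   : ∀ {a b c c'} → S a b c → S a b c' → c ≈ c'
    assocˡ   : ∀ {a b c d e} → S a b d → S d c e → ∃[ f ] (S b c f × S a f e)
    assocʳ   : ∀ {a b c f e} → S b c f → S a f e → ∃[ d ] (S a b d × S d c e)
    conj     : ∀ {a b c} → S a b c → ∃[ d ] ∃[ e ] (S d a c × S b e c)
    cancelˡ  : ∀ {a b c d} → S a b d → S a c d → b ≈ c
    cancelʳ  : ∀ {a b c d} → S b a d → S c a d → b ≈ c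
    neutralʳ : ∀ a → S a 𝟘 a
    neutralˡ : ∀ a → S 𝟘 a a
    positive : ∀ {a b} → S a b 𝟘 → (a ≈ 𝟘) × (b ≈ 𝟘)

Leq : {A : Set} → SumRel A → A → A → Set
Leq S a b = ∃[ c ] S a c b

record IsAutomorphism {A : Set} (_≈_ : Rel A 0ℓ) (S : SumRel A) (γ : A → A) : Set where
  field
    γ-cong : ∀ {a b} → a ≈ b → γ a ≈ γ b
    γ-inj  : ∀ {a b} → γ a ≈ γ b → a ≈ b
    γ-surj : ∀ b → ∃[ a ] (γ a ≈ b)
    γ-hom  : ∀ a b c → S a b c ⇔ S (γ a) (γ b) (γ c)

record IsUnitizingAutomorphism {A : Set} (_≈_ : Rel A 0ℓ) (S : SumRel A) (γ : A → A) : Set where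
  field
    isAutomorphism : IsAutomorphism _≈_ S γ
    unitizing      : ∀ a b → (∃[ c ] S (γ a) b c) ⇔ (∃[ c ] S b a c)

-- The γ-unitization U = P ∪ P^η, with inj₁ a = a ∈ P and inj₂ a = η a.
--   a + η b defined iff a ≤ b, equal to η (b \ a)   (b \ a = c with c ⊕ a = b)
--   η a + b defined iff γ b ≤ a, equal to η (γ b / a) (γ b / a = c with γ b ⊕ c = a)
USum : {A : Set} → SumRel A → (A → A) → SumRel (A ⊎ A)
USum S γ (inj₁ a) (inj₁ b) (inj₁ c) = S a b c
USum S γ (inj₁ a) (inj₂ b) (inj₂ c) = S c a b
USum S γ (inj₂ a) (inj₁ b) (inj₂ c) = S (γ b) c a
USum S γ _        _        _        = ⊥

Lift⊎ : {A : Set} → Rel A 0ℓ → Rel (A ⊎ A) 0ℓ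
Lift⊎ R (inj₁ a) (inj₁ b) = R a b
Lift⊎ R (inj₂ a) (inj₂ b) = R a b
Lift⊎ R _        _        = ⊥

QSum : {A : Set} → Rel A 0ℓ → SumRel A → SumRel A
QSum _~_ S a b c = ∃[ a₁ ] ∃[ b₁ ] ∃[ d ] ((a₁ ~ a) × (b₁ ~ b) × S a₁ b₁ d × (d ~ c))

record IsCongruence {A : Set} (S : SumRel A) (_~_ : Rel A 0ℓ) : Set where
  field
    isEquivalence : IsEquivalence _~_
    C2  : ∀ {a b c a₁ b₁ c₁} → S a b c → S a₁ b₁ c₁ → a ~ a₁ → b ~ b₁ → c ~ c₁
    C3ˡ : ∀ {a b c a₁} → S a b c → a₁ ~ a → ∃[ b₁ ] ∃[ c₁ ] ((b₁ ~ b) × S a₁ b₁ c₁)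
    C3ʳ : ∀ {a b c b₂} → S a b c → b₂ ~ b → ∃[ a₂ ] ∃[ c₂ ] ((a₂ ~ a) × S a₂ b₂ c₂)

record C4 {A : Set} (S : SumRel A) (_~_ : Rel A 0ℓ) : Set where
  field
    C4ˡ : ∀ {a b a₁ b₁ c d} → a ~ b → S a a₁ c → S b b₁ d → c ~ d → a₁ ~ b₁
    C4ʳ : ∀ {a b a₁ b₁ c d} → a ~ b → S a₁ a c → S b₁ b d → c ~ d → a₁ ~ b₁

C5' : {A : Set} → SumRel A → Rel A 0ℓ → Set
C5' S _~_ = ∀ {a b c d} → S b c d → a ~ d →
  ∃[ a₁ ] ∃[ a₂ ] (S a₁ a₂ a × (a₁ ~ b) × (a₂ ~ c))

Isγ-compatible : {A : Set} → Rel A 0ℓ → (A → A) → Set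
Isγ-compatible _~_ γ = ∀ a b → (a ~ b) ⇔ (γ a ~ γ b)

record IsIdeal {A : Set} (S : SumRel A) (I : A → Set) : Set where
  field
    nonempty : ∃[ i ] I i
    downset  : ∀ {a b} → Leq S a b → I b → I a
    sumClosed : ∀ {a b c} → S a b c → I a → I b → I c

IsNormal : {A : Set} → SumRel A → (A → Set) → Set
IsNormal S I = ∀ {a b c d} → S a c d → S c b d → I a ⇔ I b

Isγ-ideal : {A : Set} → (A → Set) → (A → A) → Set
Isγ-ideal I γ = ∀ a → I a ⇔ I (γ a)

record IsRieszIdeal {A : Set} (S : SumRel A) (I : A → Set) : Set where
  field
    isIdeal : IsIdeal S I
    R1 : ∀ {i a b c} → I i → S a b c → Leq S i c →
         ∃[ j ] ∃[ k ] (I j × I k × Leq S j a × Leq S k b ×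
                        ∃[ m ] (S j k m × Leq S i m))
    -- (R2), first half: (a \ i) = d, i.e. d ⊕ i = a;  (j / b) = e, i.e. j ⊕ e = b
    R2ˡ : ∀ {i a b d} → I i → Leq S i a → S d i a → (∃[ x ] S d b x) →
          ∃[ j ] (I j × ∃[ e ] (S j e b × ∃[ x ] S a e x))
    -- (R2), second half: (i / a) = f, i.e. i ⊕ f = a;  (b \ k) = g, i.e. g ⊕ k = b
    R2ʳ : ∀ {i a b f} → I i → Leq S i a → S i f a → (∃[ x ] S b f x) →
          ∃[ k ] (I k × ∃[ g ] (S g k b × ∃[ x ] S g a x))

∼I : {A : Set} → SumRel A → (A → Set) → Rel A 0ℓ
∼I S I a b = ∃[ i ] ∃[ j ] ∃[ d ] (I i × I j × S d i a × S d j b)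

GCR : {A : Set} → SumRel A → (A → Set) → Set
GCR S I = ∀ {a b} → ∼I S I a b →
  ∃[ i ] ∃[ j ] ∃[ c ] (I i × I j × S i a c × S j b c)

-- Conclusion for a relation ~ on P:
--  * P/~ (carrier P, equality ~, sum QSum) is a GPEA,
--  * γ̃[a] = [γ a] is a unitizing automorphism of P/~,
--  * U/~* is the γ̃-unitization of P/~: under the identification
--    [a] ↦ [a], [η a] ↦ η[a], the sums of U/~* and of the
--    γ̃-unitization of P/~ coincide.
QuotientUnitization : {P : Set} → SumRel P → P → (P → P) → Rel P 0ℓ → Set
QuotientUnitization S 𝟘 γ _~_ =
  IsGPEA _ _~_ (QSum _~_ S) 𝟘 ×
  IsUnitizingAutomorphism _~_ (QSum _~_ S) γ ×
  (∀ x y z → QSum (Lift⊎ _~_) (USum S γ) x y z ⇔ USum (QSum _~_ S) γ x y z)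

module Submission where

--  1. For any congruence ~ on a GPEA P satisfying (C4) and whose zero class
--     is closed under summands, P/~ is again a GPEA (module QuotientGPEA).
--  2. For any γ-compatible relation ~, γ̃[a] = [γ a] is a unitizing
--     automorphism of P/~, and the sums of U/~* coincide with those of the
--     γ̃-unitization of P/~ (module QuotientAutomorphism).

open import Defs
open import Level using (0ℓ)
open import Data.Product using (_×_; _,_; ∃-syntax)
open import Data.Sum using (inj₁; inj₂)
open import Relation.Binary.Core using (Rel)
open import Relation.Binary.Definitions using (Reflexive; Symmetric)
open import Relation.Binary.Structures using (IsEquivalence)
open import Relation.Binary.PropositionalEquality using (_≡_; refl)
open import Function.Bundles using (_⇔_; mk⇔; Equivalence)

open Equivalence using (to; from)

-- The zero class of ~ is closed under summands: a ⊕ b ~ 0 forces a ~ 0 and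
-- b ~ 0.  This is exactly what positivity of the quotient needs.
ZeroClassPositive : {A : Set} → SumRel A → A → Rel A 0ℓ → Set
ZeroClassPositive S 𝟘 _~_ = ∀ {a b d} → S a b d → d ~ 𝟘 → (a ~ 𝟘) × (b ~ 𝟘)

-- Layer 1: the quotient of a GPEA by a congruence.  Well-definedness,
-- associativity and conjugation use only (C2) and (C3).
module QuotientGPEA {P : Set} {S : SumRel P} {𝟘 : P} (G : IsGPEA P _≡_ S 𝟘)
                    {_~_ : Rel P 0ℓ} (C : IsCongruence S _~_) where
  private
    module G = IsGPEA G
  open IsCongruence C
  open IsEquivalence isEquivalence
    renaming (refl to ~-refl; sym to ~-sym; trans to ~-trans)

  S̃ : SumRel P
  S̃ = QSum _~_ S

  class-sum : ∀ {a b c} → S a b c → S̃ a b c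
  class-sum s = _ , _ , _ , ~-refl , ~-refl , s , ~-refl

  S̃-resp : ∀ {a a' b b' c c'} → a ~ a' → b ~ b' → c ~ c' → S̃ a b c → S̃ a' b' c'
  S̃-resp a~a' b~b' c~c' (a₁ , b₁ , c₁ , a₁~a , b₁~b , s , c₁~c) =
    a₁ , b₁ , c₁ , ~-trans a₁~a a~a' , ~-trans b₁~b b~b' , s , ~-trans c₁~c c~c'

  S̃-func : ∀ {a b c c'} → S̃ a b c → S̃ a b c' → c ~ c'
  S̃-func (a₁ , b₁ , c₁ , a₁~a , b₁~b , s , c₁~c) (a₂ , b₂ , c₂ , a₂~a , b₂~b , s' , c₂~c') =
    ~-trans (~-sym c₁~c)
      (~-trans (C2 s s' (~-trans a₁~a (~-sym a₂~a)) (~-trans b₁~b (~-sym b₂~b))) c₂~c')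

  -- By (C3) and (C2), a sum of classes can be computed from any chosen
  -- representative of its left (resp. right) summand.
  choose-left : ∀ {a b c a₁} → S̃ a b c → a₁ ~ a →
                ∃[ b₁ ] ∃[ c₁ ] (b₁ ~ b × S a₁ b₁ c₁ × c₁ ~ c)
  choose-left (a₂ , b₂ , c₂ , a₂~a , b₂~b , s , c₂~c) a₁~a
    with C3ˡ s (~-trans a₁~a (~-sym a₂~a))
  ... | b₁ , c₁ , b₁~b₂ , s₁ =
    b₁ , c₁ , ~-trans b₁~b₂ b₂~b , s₁ ,
    ~-trans (C2 s₁ s (~-trans a₁~a (~-sym a₂~a)) b₁~b₂) c₂~c

  choose-right : ∀ {a b c b₁} → S̃ a b c → b₁ ~ b →
                 ∃[ a₁ ] ∃[ c₁ ] (a₁ ~ a × S a₁ b₁ c₁ × c₁ ~ c)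
  choose-right (a₂ , b₂ , c₂ , a₂~a , b₂~b , s , c₂~c) b₁~b
    with C3ʳ s (~-trans b₁~b (~-sym b₂~b))
  ... | a₁ , c₁ , a₁~a₂ , s₁ =
    a₁ , c₁ , ~-trans a₁~a₂ a₂~a , s₁ ,
    ~-trans (C2 s₁ s a₁~a₂ (~-trans b₁~b (~-sym b₂~b))) c₂~c

  S̃-assocˡ : ∀ {a b c d e} → S̃ a b d → S̃ d c e → ∃[ f ] (S̃ b c f × S̃ a f e)
  S̃-assocˡ (a₁ , b₁ , d₁ , a₁~a , b₁~b , s , d₁~d) sde with choose-left sde d₁~d
  ... | c₁ , e₁ , c₁~c , s' , e₁~e with G.assocˡ s s'
  ... | f , sbc , saf =
    f , (b₁ , c₁ , f , b₁~b , c₁~c , sbc , ~-refl) , (a₁ , f , e₁ , a₁~a , ~-refl , saf , e₁~e)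

  S̃-assocʳ : ∀ {a b c f e} → S̃ b c f → S̃ a f e → ∃[ d ] (S̃ a b d × S̃ d c e)
  S̃-assocʳ (b₁ , c₁ , f₁ , b₁~b , c₁~c , s , f₁~f) saf with choose-right saf f₁~f
  ... | a₁ , e₁ , a₁~a , s' , e₁~e with G.assocʳ s s'
  ... | d , sab , sdc =
    d , (a₁ , b₁ , d , a₁~a , b₁~b , sab , ~-refl) , (d , c₁ , e₁ , ~-refl , c₁~c , sdc , e₁~e)

  S̃-conj : ∀ {a b c} → S̃ a b c → ∃[ d ] ∃[ e ] (S̃ d a c × S̃ b e c)
  S̃-conj (a₁ , b₁ , c₁ , a₁~a , b₁~b , s , c₁~c) with G.conj s
  ... | d , e , sda , sbe =
    d , e , (d , a₁ , c₁ , ~-refl , a₁~a , sda , c₁~c) , (b₁ , e , c₁ , b₁~b , ~-refl , sbe , c₁~c)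

  -- Cancellation in the quotient is precisely (C4).
  S̃-cancelˡ : C4 S _~_ → ∀ {a b c d} → S̃ a b d → S̃ a c d → b ~ c
  S̃-cancelˡ c4 (a₁ , b₁ , d₁ , a₁~a , b₁~b , s , d₁~d)
                (a₂ , c₂ , d₂ , a₂~a , c₂~c , s' , d₂~d) =
    ~-trans (~-sym b₁~b)
      (~-trans (C4.C4ˡ c4 (~-trans a₁~a (~-sym a₂~a)) s s' (~-trans d₁~d (~-sym d₂~d))) c₂~c)

  S̃-cancelʳ : C4 S _~_ → ∀ {a b c d} → S̃ b a d → S̃ c a d → b ~ c
  S̃-cancelʳ c4 (b₁ , a₁ , d₁ , b₁~b , a₁~a , s , d₁~d)
                (c₂ , a₂ , d₂ , c₂~c , a₂~a , s' , d₂~d) =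
    ~-trans (~-sym b₁~b)
      (~-trans (C4.C4ʳ c4 (~-trans a₁~a (~-sym a₂~a)) s s' (~-trans d₁~d (~-sym d₂~d))) c₂~c)

  S̃-positive : ZeroClassPositive S 𝟘 _~_ → ∀ {a b} → S̃ a b 𝟘 → (a ~ 𝟘) × (b ~ 𝟘)
  S̃-positive zero-pos (a₁ , b₁ , d , a₁~a , b₁~b , s , d~𝟘) with zero-pos s d~𝟘
  ... | a₁~𝟘 , b₁~𝟘 = ~-trans (~-sym a₁~a) a₁~𝟘 , ~-trans (~-sym b₁~b) b₁~𝟘

  quotient-isGPEA : C4 S _~_ → ZeroClassPositive S 𝟘 _~_ → IsGPEA P _~_ S̃ 𝟘
  quotient-isGPEA c4 zero-pos = record
    { isEquivalence = isEquivalence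
    ; S-resp        = S̃-resp
    ; S-func        = S̃-func
    ; assocˡ        = S̃-assocˡ
    ; assocʳ        = S̃-assocʳ
    ; conj          = S̃-conj
    ; cancelˡ       = S̃-cancelˡ c4
    ; cancelʳ       = S̃-cancelʳ c4
    ; neutralʳ      = λ a → class-sum (G.neutralʳ a)
    ; neutralˡ      = λ a → class-sum (G.neutralˡ a)
    ; positive      = S̃-positive zero-pos
    }

module QuotientAutomorphism {P : Set} {S : SumRel P} {γ : P → P}
                            (A : IsAutomorphism _≡_ S γ)
                            {_~_ : Rel P 0ℓ} (γ-compat : Isγ-compatible _~_ γ) where
  open IsAutomorphism A

  S̃ : SumRel P
  S̃ = QSum _~_ S

  γ̃-cong : ∀ {a b} → a ~ b → γ a ~ γ b
  γ̃-cong = to (γ-compat _ _)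

  γ̃-inj : ∀ {a b} → γ a ~ γ b → a ~ b
  γ̃-inj = from (γ-compat _ _)

  γ̃-preserves : ∀ {a b c} → S̃ a b c → S̃ (γ a) (γ b) (γ c)
  γ̃-preserves (a₁ , b₁ , c₁ , a₁~a , b₁~b , s , c₁~c) =
    γ a₁ , γ b₁ , γ c₁ , γ̃-cong a₁~a , γ̃-cong b₁~b , to (γ-hom _ _ _) s , γ̃-cong c₁~c

  -- The representatives of a sum of γ-images are themselves γ-images (γ is
  -- onto), so the sum can be pulled back along γ.
  γ̃-reflects : ∀ {a b c} → S̃ (γ a) (γ b) (γ c) → S̃ a b c
  γ̃-reflects (a₁ , b₁ , c₁ , a₁~ , b₁~ , s , c₁~)
    with γ-surj a₁ | γ-surj b₁ | γ-surj c₁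
  ... | a₀ , refl | b₀ , refl | c₀ , refl =
    a₀ , b₀ , c₀ , γ̃-inj a₁~ , γ̃-inj b₁~ , from (γ-hom _ _ _) s , γ̃-inj c₁~

  quotient-isAutomorphism : Reflexive _~_ → IsAutomorphism _~_ S̃ γ
  quotient-isAutomorphism ~-refl = record
    { γ-cong = γ̃-cong
    ; γ-inj  = γ̃-inj
    ; γ-surj = γ̃-surj
    ; γ-hom  = λ a b c → mk⇔ γ̃-preserves γ̃-reflects
    }
    where
    γ̃-surj : ∀ b → ∃[ a ] (γ a ~ b)
    γ̃-surj b with γ-surj b
    ... | a , refl = a , ~-refl

  -- The unitizing condition passes to the quotient: it is checked on
  -- representatives, after pulling the left one back along γ.
  quotient-isUnitizingAutomorphism : (∀ a b → (∃[ c ] S (γ a) b c) ⇔ (∃[ c ] S b a c)) →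
                                     Reflexive _~_ → IsUnitizingAutomorphism _~_ S̃ γ
  quotient-isUnitizingAutomorphism unitizing ~-refl = record
    { isAutomorphism = quotient-isAutomorphism ~-refl
    ; unitizing      = λ a b → mk⇔ γ̃a⊕b⇒b⊕a b⊕a⇒γ̃a⊕b
    }
    where
    γ̃a⊕b⇒b⊕a : ∀ {a b} → ∃[ c ] S̃ (γ a) b c → ∃[ c ] S̃ b a c
    γ̃a⊕b⇒b⊕a (_ , g , b₁ , _ , g~γa , b₁~b , s , _) with γ-surj g
    ... | a₁ , refl with to (unitizing a₁ b₁) (_ , s)
    ... | c , s' = c , b₁ , a₁ , c , b₁~b , γ̃-inj g~γa , s' , ~-refl

    b⊕a⇒γ̃a⊕b : ∀ {a b} → ∃[ c ] S̃ b a c → ∃[ c ] S̃ (γ a) b c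
    b⊕a⇒γ̃a⊕b (_ , b₁ , a₁ , _ , b₁~b , a₁~a , s , _) with from (unitizing a₁ b₁) (_ , s)
    ... | c , s' = c , γ a₁ , b₁ , c , γ̃-cong a₁~a , b₁~b , s' , ~-refl

  -- In each of the
  -- three kinds of defined sums the representatives can be passed across
  -- unchanged, except that γ b₁ represents γ̃[b]; all other cases are void.
  U/~*⇒unitization : ∀ x y z → QSum (Lift⊎ _~_) (USum S γ) x y z → USum S̃ γ x y z
  U/~*⇒unitization (inj₁ _) (inj₁ _) (inj₁ _) (inj₁ a₁ , inj₁ b₁ , inj₁ c₁ , a₁~ , b₁~ , s , c₁~) =
    a₁ , b₁ , c₁ , a₁~ , b₁~ , s , c₁~
  U/~*⇒unitization (inj₁ _) (inj₂ _) (inj₂ _) (inj₁ a₁ , inj₂ b₁ , inj₂ c₁ , a₁~ , b₁~ , s , c₁~) =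
    c₁ , a₁ , b₁ , c₁~ , a₁~ , s , b₁~
  U/~*⇒unitization (inj₂ _) (inj₁ _) (inj₂ _) (inj₂ a₁ , inj₁ b₁ , inj₂ c₁ , a₁~ , b₁~ , s , c₁~) =
    γ b₁ , c₁ , a₁ , γ̃-cong b₁~ , c₁~ , s , a₁~
  U/~*⇒unitization (inj₁ _) _ _ (inj₂ _ , _ , _ , () , _)
  U/~*⇒unitization (inj₂ _) _ _ (inj₁ _ , _ , _ , () , _)
  U/~*⇒unitization _ (inj₁ _) _ (_ , inj₂ _ , _ , _ , () , _)
  U/~*⇒unitization _ (inj₂ _) _ (_ , inj₁ _ , _ , _ , () , _)
  U/~*⇒unitization _ _ (inj₁ _) (_ , _ , inj₂ _ , _ , _ , _ , ())
  U/~*⇒unitization _ _ (inj₂ _) (_ , _ , inj₁ _ , _ , _ , _ , ())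
  U/~*⇒unitization (inj₁ _) (inj₁ _) (inj₂ _) (inj₁ _ , inj₁ _ , inj₂ _ , _ , _ , () , _)
  U/~*⇒unitization (inj₁ _) (inj₂ _) (inj₁ _) (inj₁ _ , inj₂ _ , inj₁ _ , _ , _ , () , _)
  U/~*⇒unitization (inj₂ _) (inj₁ _) (inj₁ _) (inj₂ _ , inj₁ _ , inj₁ _ , _ , _ , () , _)
  U/~*⇒unitization (inj₂ _) (inj₂ _) (inj₁ _) (inj₂ _ , inj₂ _ , inj₁ _ , _ , _ , () , _)
  U/~*⇒unitization (inj₂ _) (inj₂ _) (inj₂ _) (inj₂ _ , inj₂ _ , inj₂ _ , _ , _ , () , _)

  unitization⇒U/~* : ∀ x y z → USum S̃ γ x y z → QSum (Lift⊎ _~_) (USum S γ) x y z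
  unitization⇒U/~* (inj₁ _) (inj₁ _) (inj₁ _) (a₁ , b₁ , c₁ , a₁~ , b₁~ , s , c₁~) =
    inj₁ a₁ , inj₁ b₁ , inj₁ c₁ , a₁~ , b₁~ , s , c₁~
  unitization⇒U/~* (inj₁ _) (inj₂ _) (inj₂ _) (c₁ , a₁ , b₁ , c₁~ , a₁~ , s , b₁~) =
    inj₁ a₁ , inj₂ b₁ , inj₂ c₁ , a₁~ , b₁~ , s , c₁~
  unitization⇒U/~* (inj₂ _) (inj₁ _) (inj₂ _) (g , c₁ , a₁ , g~γb , c₁~ , s , a₁~) with γ-surj g
  ... | b₁ , refl = inj₂ a₁ , inj₁ b₁ , inj₂ c₁ , a₁~ , γ̃-inj g~γb , s , c₁~
  unitization⇒U/~* (inj₁ _) (inj₁ _) (inj₂ _) ()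
  unitization⇒U/~* (inj₁ _) (inj₂ _) (inj₁ _) ()
  unitization⇒U/~* (inj₂ _) (inj₁ _) (inj₁ _) ()
  unitization⇒U/~* (inj₂ _) (inj₂ _) (inj₁ _) ()
  unitization⇒U/~* (inj₂ _) (inj₂ _) (inj₂ _) ()

quotientUnitization : ∀ {P S 𝟘 γ} {_~_ : Rel P 0ℓ} →
  IsGPEA P _≡_ S 𝟘 → IsUnitizingAutomorphism _≡_ S γ →
  IsCongruence S _~_ → Isγ-compatible _~_ γ → C4 S _~_ → ZeroClassPositive S 𝟘 _~_ →
  QuotientUnitization S 𝟘 γ _~_
quotientUnitization G U C γ-compat c4 zero-pos =
  quotient-isGPEA c4 zero-pos ,
  quotient-isUnitizingAutomorphism unitizing (IsEquivalence.refl isEquivalence) ,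
  λ x y z → mk⇔ (U/~*⇒unitization x y z) (unitization⇒U/~* x y z)
  where
  open QuotientGPEA G C using (quotient-isGPEA)
  open IsCongruence C using (isEquivalence)
  open IsUnitizingAutomorphism U using (isAutomorphism; unitizing)
  open QuotientAutomorphism isAutomorphism γ-compat

-- (C5') splits a ~-null element into ~-classes of the summands; positivity
-- of P then makes both summands ~-null.
C5'⇒zeroClassPositive : ∀ {P S 𝟘} {_~_ : Rel P 0ℓ} → IsGPEA P _≡_ S 𝟘 →
                        Symmetric _~_ → C5' S _~_ → ZeroClassPositive S 𝟘 _~_
C5'⇒zeroClassPositive G ~-sym c5 s d~𝟘 with c5 s (~-sym d~𝟘)
... | a₁ , b₁ , s₀ , a₁~a , b₁~b with IsGPEA.positive G s₀
... | refl , refl = ~-sym a₁~a , ~-sym b₁~b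

module GPEAOrder {P : Set} {S : SumRel P} {𝟘 : P} (G : IsGPEA P _≡_ S 𝟘) where
  open IsGPEA G

  right-summand-≤ : ∀ {a b c} → S c a b → Leq S a b
  right-summand-≤ s with conj s
  ... | _ , e , _ , s' = e , s'

  -- By conjugation, whatever lies below b is also a right summand of b.
  ≤-right-complement : ∀ {a b} → Leq S a b → ∃[ d ] S d a b
  ≤-right-complement (_ , s) with conj s
  ... | d , _ , s' , _ = d , s'

  ≤-trans : ∀ {a b c} → Leq S a b → Leq S b c → Leq S a c
  ≤-trans (_ , sab) (_ , sbc) with assocˡ sab sbc
  ... | z , _ , s = z , s

  ⊕-monoʳ-≤ : ∀ {a b b' c c'} → S a b c → Leq S b b' → S a b' c' → Leq S c c'
  ⊕-monoʳ-≤ sab (v , sbv) sab' with assocʳ sbv sab'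
  ... | d , sad , sdv with S-func sab sad
  ... | refl = v , sdv

module IdealCongruence {P : Set} {S : SumRel P} {𝟘 : P} (G : IsGPEA P _≡_ S 𝟘)
                       {I : P → Set} (R : IsRieszIdeal S I) (N : IsNormal S I) where
  open IsGPEA G
  open IsRieszIdeal R
  open IsIdeal isIdeal
  open GPEAOrder G

  _≈_ : Rel P 0ℓ
  _≈_ = ∼I S I

  I-𝟘 : I 𝟘
  I-𝟘 with nonempty
  ... | i , Ii = downset (i , neutralˡ i) Ii

  -- Normality lets an ideal summand change sides.
  shiftʳ : ∀ {i x z} → I i → S i x z → ∃[ i' ] (I i' × S x i' z)
  shiftʳ Ii s with conj s
  ... | _ , e , _ , s' = e , to (N s s') Ii , s'

  shiftˡ : ∀ {i x z} → I i → S x i z → ∃[ i' ] (I i' × S i' x z)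
  shiftˡ Ii s with conj s
  ... | d , _ , s' , _ = d , from (N s' s) Ii , s'

  ≈-by-right : ∀ {a i w} → I i → S a i w → a ≈ w
  ≈-by-right {a} Ii s = 𝟘 , _ , a , I-𝟘 , Ii , neutralʳ a , s

  ≈-by-left : ∀ {a i w} → I i → S i a w → a ≈ w
  ≈-by-left Ii s with shiftʳ Ii s
  ... | _ , Ii' , s' = ≈-by-right Ii' s'

  ≈-refl : ∀ {a} → a ≈ a
  ≈-refl {a} = ≈-by-right I-𝟘 (neutralʳ a)

  ≈-sym : ∀ {a b} → a ≈ b → b ≈ a
  ≈-sym (i , j , d , Ii , Ij , sa , sb) = j , i , d , Ij , Ii , sb , sa

  -- With d = e ⊕ j₁ (j₁ ≤ d from R1) and f = j₁ ⊕ j ∈ I we get b = e ⊕ f and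
  -- j' ≤ j₁ ⊕ k₁ ≤ f, so f = h' ⊕ j' and d' = e ⊕ h' by cancellation.
  common-base : ∀ {b d d' j j'} → I j → I j' → S d j b → S d' j' b →
                ∃[ e ] ∃[ h ] ∃[ h' ] (I h × I h' × S e h d × S e h' d')
  common-base Ij Ij' sdj sd'j' with R1 Ij' sdj (right-summand-≤ sd'j')
  ... | j₁ , _ , Ij₁ , _ , j₁≤d , k₁≤j , _ , sj₁k₁ , j'≤m with ≤-right-complement j₁≤d
  ... | e , sej₁ with assocˡ sej₁ sdj
  ... | _ , sj₁j , sef with ≤-right-complement (≤-trans j'≤m (⊕-monoʳ-≤ sj₁k₁ k₁≤j sj₁j))
  ... | h' , sh'j' with assocʳ sh'j' sef
  ... | _ , seh' , sgj' with cancelʳ sgj' sd'j'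
  ... | refl = e , j₁ , h' , Ij₁ , downset (_ , sh'j') (sumClosed sj₁j Ij₁ Ij) , sej₁ , seh'

  ≈-trans : ∀ {a b c} → a ≈ b → b ≈ c → a ≈ c
  ≈-trans (_ , _ , _ , Ii , Ij , sa , sb) (_ , _ , _ , Ij' , Ik , sb' , sc)
    with common-base Ij Ij' sb sb'
  ... | e , h , h' , Ih , Ih' , seh , seh' with assocˡ seh sa | assocˡ seh' sc
  ... | p , shi , sa' | q , sh'k , sc' =
    p , q , e , sumClosed shi Ih Ii , sumClosed sh'k Ih' Ik , sa' , sc'

  -- If x ⊕ i = a and y ⊕ j = b with i, j ∈ I, then a ⊕ b = (x ⊕ y) ⊕ t for
  -- some t ∈ I (normality moves i past y).
  perturbed-sum : ∀ {a b c x i y j} → I i → I j → S x i a → S y j b → S a b c →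
                  ∃[ s ] ∃[ t ] (I t × S x y s × S s t c)
  perturbed-sum Ii Ij sxi syj sab with assocˡ sxi sab
  ... | _ , sib , sxf with assocʳ syj sib
  ... | _ , siy , sgj with shiftʳ Ii siy
  ... | _ , Ii' , syi' with assocˡ syi' sgj
  ... | h , si'j , syh with assocʳ syh sxf
  ... | s , sxy , ssh = s , h , sumClosed si'j Ii' Ij , sxy , ssh

  ≈-C2 : ∀ {a b c a₁ b₁ c₁} → S a b c → S a₁ b₁ c₁ → a ≈ a₁ → b ≈ b₁ → c ≈ c₁
  ≈-C2 sab sab₁ (_ , _ , _ , Ii , Ii₁ , sxi , sxi₁) (_ , _ , _ , Ij , Ij₁ , syj , syj₁)
    with perturbed-sum Ii Ij sxi syj sab | perturbed-sum Ii₁ Ij₁ sxi₁ syj₁ sab₁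
  ... | s , t , It , sxy , sst | _ , t₁ , It₁ , sxy₁ , sst₁ with S-func sxy sxy₁
  ... | refl = t , t₁ , s , It , It₁ , sst , sst₁

  -- (C3) from (R2): if a ⊕ b exists and a₁ ≈ a, the common part x of a₁
  -- and a can be added to b, and (R2) then adjusts b within its class.
  ≈-C3ˡ : ∀ {a b c a₁} → S a b c → a₁ ≈ a → ∃[ b₁ ] ∃[ c₁ ] ((b₁ ≈ b) × S a₁ b₁ c₁)
  ≈-C3ˡ sab (_ , _ , _ , Ii₁ , Ii , sxi₁ , sxi) with assocˡ sxi sab
  ... | _ , sib , sxf with shiftʳ Ii sib
  ... | _ , _ , sbi' with assocʳ sbi' sxf
  ... | g , sxb , _ with R2ˡ Ii₁ (right-summand-≤ sxi₁) sxi₁ (g , sxb)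
  ... | _ , Ij , e , sje , _ , sa₁e with shiftʳ Ij sje
  ... | _ , Ij' , sej' = e , _ , ≈-by-right Ij' sej' , sa₁e

  ≈-C3ʳ : ∀ {a b c b₂} → S a b c → b₂ ≈ b → ∃[ a₂ ] ∃[ c₂ ] ((a₂ ≈ a) × S a₂ b₂ c₂)
  ≈-C3ʳ sab (_ , _ , y , Ij₂ , _ , syj₂ , syj) with shiftˡ Ij₂ syj₂
  ... | _ , Ij₂' , sj₂'y with assocʳ syj sab
  ... | d , say , _ with R2ʳ Ij₂' (y , sj₂'y) sj₂'y (d , say)
  ... | _ , Ik , g , sgk , _ , sgb₂ = g , _ , ≈-by-right Ik sgk , sgb₂

  ≈-isCongruence : IsCongruence S _≈_
  ≈-isCongruence = record
    { isEquivalence = record { refl = ≈-refl ; sym = ≈-sym ; trans = ≈-trans }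
    ; C2  = ≈-C2
    ; C3ˡ = ≈-C3ˡ
    ; C3ʳ = ≈-C3ʳ
    }

  -- (GCR) gives cancellation up to ≈ of a common summand: with p ⊕ c = q ⊕ d
  -- (p, q ∈ I) both sums reduce to the same x ⊕ h, and cancelling x leaves
  -- u and v differing by ideal summands.
  cancelˡ-≈ : GCR S I → ∀ {x u v c d} → S x u c → S x v d → c ≈ d → u ≈ v
  cancelˡ-≈ gcr sxu sxv c≈d with gcr c≈d
  ... | _ , _ , _ , Ip , Iq , spc , sqd with assocʳ sxu spc | assocʳ sxv sqd
  ... | _ , spx , sgu | _ , sqx , sg'v with shiftʳ Ip spx | shiftʳ Iq sqx
  ... | _ , Ip' , sxp' | _ , Iq' , sxq' with assocˡ sxp' sgu | assocˡ sxq' sg'v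
  ... | _ , sp'u , sxh | _ , sq'v , sxh' with cancelˡ sxh sxh'
  ... | refl = ≈-trans (≈-by-left Ip' sp'u) (≈-sym (≈-by-left Iq' sq'v))

  cancelʳ-≈ : GCR S I → ∀ {x u v c d} → S u x c → S v x d → c ≈ d → u ≈ v
  cancelʳ-≈ gcr sux svx c≈d with gcr c≈d
  ... | _ , _ , _ , Ip , Iq , spc , sqd with shiftʳ Ip spc | shiftʳ Iq sqd
  ... | _ , Ip' , scp' | _ , Iq' , sdq' with assocˡ sux scp' | assocˡ svx sdq'
  ... | _ , sxp' , sug | _ , sxq' , svg' with shiftˡ Ip' sxp' | shiftˡ Iq' sxq'
  ... | _ , Ip'' , sp''x | _ , Iq'' , sq''x with assocʳ sp''x sug | assocʳ sq''x svg'
  ... | _ , sup'' , shx | _ , svq'' , sh'x with cancelʳ shx sh'x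
  ... | refl = ≈-trans (≈-by-right Ip'' sup'') (≈-sym (≈-by-right Iq'' svq''))

  -- (C4): write a = x ⊕ i, b = x ⊕ j and cancel x from the two sums.
  ≈-C4 : GCR S I → C4 S _≈_
  ≈-C4 gcr = record { C4ˡ = ≈-C4ˡ ; C4ʳ = ≈-C4ʳ }
    where
    ≈-C4ˡ : ∀ {a b a₁ b₁ c d} → a ≈ b → S a a₁ c → S b b₁ d → c ≈ d → a₁ ≈ b₁
    ≈-C4ˡ (_ , _ , _ , Ii , Ij , sxi , sxj) sa sb c≈d with assocˡ sxi sa | assocˡ sxj sb
    ... | _ , sia₁ , sxf | _ , sjb₁ , sxf' =
      ≈-trans (≈-by-left Ii sia₁)
        (≈-trans (cancelˡ-≈ gcr sxf sxf' c≈d) (≈-sym (≈-by-left Ij sjb₁)))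

    ≈-C4ʳ : ∀ {a b a₁ b₁ c d} → a ≈ b → S a₁ a c → S b₁ b d → c ≈ d → a₁ ≈ b₁
    ≈-C4ʳ (_ , _ , _ , Ii , Ij , sxi , sxj) sa sb c≈d with shiftˡ Ii sxi | shiftˡ Ij sxj
    ... | _ , Ii' , si'x | _ , Ij' , sj'x with assocʳ si'x sa | assocʳ sj'x sb
    ... | _ , sa₁i' , sfx | _ , sb₁j' , sf'x =
      ≈-trans (≈-by-right Ii' sa₁i')
        (≈-trans (cancelʳ-≈ gcr sfx sf'x c≈d) (≈-sym (≈-by-right Ij' sb₁j')))

  -- The zero class of ≈ is I itself; as I is a down-set, it is closed under summands.
  ≈𝟘⇒I : ∀ {d} → d ≈ 𝟘 → I d
  ≈𝟘⇒I (i , _ , _ , Ii , _ , sei , se𝟘) with positive se𝟘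
  ... | refl , refl with S-func (neutralˡ i) sei
  ... | refl = Ii

  I⇒≈𝟘 : ∀ {a} → I a → a ≈ 𝟘
  I⇒≈𝟘 {a} Ia = ≈-sym (≈-by-right Ia (neutralˡ a))

  ≈-zeroClassPositive : ZeroClassPositive S 𝟘 _≈_
  ≈-zeroClassPositive sab d≈𝟘 =
    I⇒≈𝟘 (downset (_ , sab) (≈𝟘⇒I d≈𝟘)) , I⇒≈𝟘 (downset (right-summand-≤ sab) (≈𝟘⇒I d≈𝟘))

  -- For a γ-ideal, γ maps the witnesses of a ≈ b to witnesses of γ a ≈ γ b
  -- and, being onto, back again.
  ≈-γ-compatible : ∀ {γ} → IsAutomorphism _≡_ S γ → Isγ-ideal I γ → Isγ-compatible _≈_ γ
  ≈-γ-compatible {γ} A Iγ a b = mk⇔ forward backward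
    where
    open IsAutomorphism A

    forward : a ≈ b → γ a ≈ γ b
    forward (i , j , d , Ii , Ij , sa , sb) =
      γ i , γ j , γ d , to (Iγ i) Ii , to (Iγ j) Ij , to (γ-hom _ _ _) sa , to (γ-hom _ _ _) sb

    backward : γ a ≈ γ b → a ≈ b
    backward (i , j , d , Ii , Ij , sa , sb) with γ-surj i | γ-surj j | γ-surj d
    ... | i₀ , refl | j₀ , refl | d₀ , refl =
      i₀ , j₀ , d₀ , from (Iγ i₀) Ii , from (Iγ j₀) Ij , from (γ-hom _ _ _) sa , from (γ-hom _ _ _) sb

theorem4p22 : (P : Set) (S : SumRel P) (𝟘 : P) → IsGPEA P _≡_ S 𝟘 →
    (γ : P → P) → IsUnitizingAutomorphism _≡_ S γ →
    ((_~_ : Rel P 0ℓ) → IsCongruence S _~_ → Isγ-compatible _~_ γ →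
       C4 S _~_ → C5' S _~_ → QuotientUnitization S 𝟘 γ _~_)
    ×
    ((I : P → Set) → IsRieszIdeal S I → IsNormal S I → Isγ-ideal I γ →
       GCR S I → QuotientUnitization S 𝟘 γ (∼I S I))
theorem4p22 P S 𝟘 G γ U = congruenceCase , idealCase
  where
  congruenceCase : (_~_ : Rel P 0ℓ) → IsCongruence S _~_ → Isγ-compatible _~_ γ →
                   C4 S _~_ → C5' S _~_ → QuotientUnitization S 𝟘 γ _~_
  congruenceCase _~_ C γ-compat c4 c5 =
    quotientUnitization G U C γ-compat c4
      (C5'⇒zeroClassPositive G (IsEquivalence.sym (IsCongruence.isEquivalence C)) c5)

  idealCase : (I : P → Set) → IsRieszIdeal S I → IsNormal S I → Isγ-ideal I γ →
              GCR S I → QuotientUnitization S 𝟘 γ (∼I S I)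
  idealCase I R N Iγ gcr =
    quotientUnitization G U ≈-isCongruence
      (≈-γ-compatible (IsUnitizingAutomorphism.isAutomorphism U) Iγ) (≈-C4 gcr) ≈-zeroClassPositive
    where open IdealCongruence G R N
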